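{- Let $G_1$ be a complete graph and $G_2$ an arbitrary graph on a disjoint vertex set. Then $\theta_c(G_1\vee G_2)=\min\{\theta_c(G_2),\ 1+\theta(G_2)\}$.
   Context: Graphs are finite, simple, undirected. $G_1\vee G_2$ is the join: the disjoint union plus all edges between $V(G_1)$ and $V(G_2)$. A set $S\subseteq V(G)$ is a clique deletion set of $G$ if $G-S$ is a clique; it is a connected clique deletion set if moreover $G[S]$ is connected. $\theta(G)$ and $\theta_c(G)$ denote the minimum sizes of a clique deletion set and a connected clique deletion set of $G$, respectively ($\theta_c(G)=\infty$ if none exists). -}

module Defs where

open import Data.Nat using (ℕ; zero; suc; _+_; _≤_)
open import Data.Fin using (Fin; splitAt)
open import Data.Fin.Subset using (Subset; _∈_; _∉_; ∣_∣)
open import Data.Bool using (Bool; true; false; T)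
open import Data.Sum using (_⊎_; inj₁; inj₂)
open import Data.Product using (Σ; _×_; _,_)
open import Data.Maybe using (Maybe; just; nothing)
open import Relation.Nullary using (¬_)
open import Relation.Binary.PropositionalEquality using (_≡_; _≢_; refl)

record Graph (n : ℕ) : Set where
  field
    E      : Fin n → Fin n → Bool
    sym    : ∀ u v → E u v ≡ E v u
    irrefl : ∀ u → E u u ≡ false

open Graph public

Adj : ∀ {n} → Graph n → Fin n → Fin n → Set
Adj G u v = T (E G u v)

IsComplete : ∀ {n} → Graph n → Set
IsComplete {n} G = ∀ (u v : Fin n) → u ≢ v → Adj G u v

joinE : ∀ {m n} → Graph m → Graph n → Fin (m + n) → Fin (m + n) → Bool
joinE {m} G₁ G₂ x y with splitAt m x | splitAt m y
... | inj₁ a | inj₁ b = E G₁ a b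
... | inj₁ a | inj₂ b = true
... | inj₂ a | inj₁ b = true
... | inj₂ a | inj₂ b = E G₂ a b

joinE-sym : ∀ {m n} (G₁ : Graph m) (G₂ : Graph n) x y →
            joinE G₁ G₂ x y ≡ joinE G₁ G₂ y x
joinE-sym {m} G₁ G₂ x y with splitAt m x | splitAt m y
... | inj₁ a | inj₁ b = sym G₁ a b
... | inj₁ a | inj₂ b = refl
... | inj₂ a | inj₁ b = refl
... | inj₂ a | inj₂ b = sym G₂ a b

joinE-irrefl : ∀ {m n} (G₁ : Graph m) (G₂ : Graph n) x →
               joinE G₁ G₂ x x ≡ false
joinE-irrefl {m} G₁ G₂ x with splitAt m x
... | inj₁ a = irrefl G₁ a
... | inj₂ a = irrefl G₂ a

_∨G_ : ∀ {m n} → Graph m → Graph n → Graph (m + n)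
G₁ ∨G G₂ = record
  { E = joinE G₁ G₂ ; sym = joinE-sym G₁ G₂ ; irrefl = joinE-irrefl G₁ G₂ }

IsCDS : ∀ {n} → Graph n → Subset n → Set
IsCDS {n} G S = ∀ (u v : Fin n) → u ∉ S → v ∉ S → u ≢ v → Adj G u v

data ReachIn {n} (G : Graph n) (S : Subset n) (u : Fin n) : Fin n → Set where
  here : u ∈ S → ReachIn G S u u
  step : ∀ {w v} → ReachIn G S u w → v ∈ S → Adj G w v → ReachIn G S u v

-- G[S] is connected (the empty vertex set counts as connected).
ConnectedIn : ∀ {n} → Graph n → Subset n → Set
ConnectedIn {n} G S = ∀ (u v : Fin n) → u ∈ S → v ∈ S → ReachIn G S u v

IsCCDS : ∀ {n} → Graph n → Subset n → Set
IsCCDS G S = IsCDS G S × ConnectedIn G S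

IsTheta : ∀ {n} → Graph n → ℕ → Set
IsTheta {n} G k =
  Σ (Subset n) (λ S → IsCDS G S × ∣ S ∣ ≡ k) ×
  (∀ (S : Subset n) → IsCDS G S → k ≤ ∣ S ∣)

-- Extended naturals: nothing = ∞.
ℕ∞ : Set
ℕ∞ = Maybe ℕ

min∞ : ℕ∞ → ℕ∞ → ℕ∞
min∞ nothing  b        = b
min∞ (just a) nothing  = just a
min∞ (just a) (just b) = just (Data.Nat._⊓_ a b)

-- θ_c(G) = v  (v = nothing means no connected clique deletion set exists).
IsThetaC : ∀ {n} → Graph n → ℕ∞ → Set
IsThetaC {n} G nothing  = ∀ (S : Subset n) → ¬ IsCCDS G S
IsThetaC {n} G (just k) =
  Σ (Subset n) (λ S → IsCCDS G S × ∣ S ∣ ≡ k) ×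
  (∀ (S : Subset n) → IsCCDS G S → k ≤ ∣ S ∣)

-- Write a connected clique deletion set T of G₁ ∨ G₂ as A ∪ B with A ⊆ V(G₁),
-- B ⊆ V(G₂). Since G₁ is complete and joined to all of G₂, every non-edge of
-- the join lies in G₂, so B is a clique deletion set of G₂. If A = ∅ then T
-- induces G₂[B], so B is connected and |T| = |B| ≥ θ_c(G₂); otherwise
-- |T| ≥ 1 + |B| ≥ 1 + θ(G₂). Conversely a connected clique deletion set of G₂
-- stays one in the join, and adding a single vertex of G₁ to any clique
-- deletion set of G₂ makes it connected, that vertex being adjacent to all of G₂.
module Submission where

open import Defs renaming (sym to E-sym)
open import Data.Nat using (ℕ; suc; _+_; _≤_; _⊓_; s≤s; z≤n)
open import Data.Nat.Properties
  using (≤-refl; ≤-reflexive; ≤-trans; ⊓-sel; m⊓n≤m; m⊓n≤n; +-mono-≤)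
open import Data.Fin using (Fin; zero; splitAt; _↑ˡ_; _↑ʳ_; _≟_)
open import Data.Fin.Properties
  using (splitAt-↑ˡ; splitAt-↑ʳ; splitAt⁻¹-↑ˡ; splitAt⁻¹-↑ʳ; ↑ʳ-injective)
open import Data.Fin.Subset using (Subset; _∈_; ∣_∣; ⊥; ⁅_⁆; inside; outside)
open import Data.Fin.Subset.Properties
  using (∉⊥; ∣⊥∣≡0; ∣⁅x⁆∣≡1; x∈⁅x⁆; x∈⁅y⁆⇒x≡y; nonempty?; Empty-unique; x∈p⇒∣p-x∣<∣p∣)
open import Data.Vec using (_∷_; []; _++_)
import Data.Vec as Vec
open import Data.Vec.Properties using (lookup-++ˡ; lookup-++ʳ; []=⇒lookup; lookup⇒[]=)
open import Data.Bool using (T)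
open import Data.Unit using (tt)
open import Data.Empty using (⊥-elim)
open import Data.Maybe using (just; nothing)
open import Data.Sum using (_⊎_; inj₁; inj₂)
open import Data.Product using (Σ; _×_; _,_; proj₁; proj₂)
open import Relation.Nullary using (¬_; yes; no)
open import Relation.Binary.PropositionalEquality
  using (_≡_; _≢_; refl; sym; trans; cong; subst)

data SplitView (m n : ℕ) : Fin (m + n) → Set where
  left  : (i : Fin m) → SplitView m n (i ↑ˡ n)
  right : (j : Fin n) → SplitView m n (m ↑ʳ j)

splitView : ∀ m {n} (x : Fin (m + n)) → SplitView m n x
splitView m x with splitAt m x in eq
... | inj₁ i = subst (SplitView m _) (splitAt⁻¹-↑ˡ eq) (left i)
... | inj₂ j = subst (SplitView m _) (splitAt⁻¹-↑ʳ eq) (right j)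

module _ {m n : ℕ} {p : Subset m} {q : Subset n} where

  ∈-++⁺ˡ : ∀ {i} → i ∈ p → (i ↑ˡ n) ∈ p ++ q
  ∈-++⁺ˡ {i} i∈p = lookup⇒[]= _ (p ++ q) (trans (lookup-++ˡ p q i) ([]=⇒lookup i∈p))

  ∈-++⁻ˡ : ∀ {i} → (i ↑ˡ n) ∈ p ++ q → i ∈ p
  ∈-++⁻ˡ {i} i∈p++q =
    lookup⇒[]= i p (trans (sym (lookup-++ˡ p q i)) ([]=⇒lookup i∈p++q))

  ∈-++⁺ʳ : ∀ {j} → j ∈ q → (m ↑ʳ j) ∈ p ++ q
  ∈-++⁺ʳ {j} j∈q = lookup⇒[]= _ (p ++ q) (trans (lookup-++ʳ p q j) ([]=⇒lookup j∈q))

  ∈-++⁻ʳ : ∀ {j} → (m ↑ʳ j) ∈ p ++ q → j ∈ q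
  ∈-++⁻ʳ {j} j∈p++q =
    lookup⇒[]= j q (trans (sym (lookup-++ʳ p q j)) ([]=⇒lookup j∈p++q))

∣p++q∣≡∣p∣+∣q∣ : ∀ {m n} (p : Subset m) (q : Subset n) → ∣ p ++ q ∣ ≡ ∣ p ∣ + ∣ q ∣
∣p++q∣≡∣p∣+∣q∣ []            q = refl
∣p++q∣≡∣p∣+∣q∣ (inside  ∷ p) q = cong suc (∣p++q∣≡∣p∣+∣q∣ p q)
∣p++q∣≡∣p∣+∣q∣ (outside ∷ p) q = ∣p++q∣≡∣p∣+∣q∣ p q

∣⊥++q∣≡∣q∣ : ∀ m {n} (q : Subset n) → ∣ ⊥ {m} ++ q ∣ ≡ ∣ q ∣
∣⊥++q∣≡∣q∣ m q = trans (∣p++q∣≡∣p∣+∣q∣ (⊥ {m}) q) (cong (_+ ∣ q ∣) (∣⊥∣≡0 m))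

∣⁅c⁆++q∣≡1+∣q∣ : ∀ {m n} (c : Fin m) (q : Subset n) → ∣ ⁅ c ⁆ ++ q ∣ ≡ suc ∣ q ∣
∣⁅c⁆++q∣≡1+∣q∣ c q = trans (∣p++q∣≡∣p∣+∣q∣ ⁅ c ⁆ q) (cong (_+ ∣ q ∣) (∣⁅x⁆∣≡1 c))

x∈p⇒1≤∣p∣ : ∀ {m} {p : Subset m} {x} → x ∈ p → 1 ≤ ∣ p ∣
x∈p⇒1≤∣p∣ x∈p = ≤-trans (s≤s z≤n) (x∈p⇒∣p-x∣<∣p∣ x∈p)

Adj-sym : ∀ {k} (G : Graph k) {u v} → Adj G u v → Adj G v u
Adj-sym G {u} {v} = subst T (E-sym G u v)

ReachIn-∈ : ∀ {k} {G : Graph k} {S u v} → ReachIn G S u v → v ∈ S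
ReachIn-∈ (here u∈S)     = u∈S
ReachIn-∈ (step _ v∈S _) = v∈S

module _ {k} (G : Graph k) {S : Subset k} {h : Fin k} (h∈S : h ∈ S)
         (hub : ∀ {x} → x ∈ S → x ≢ h → Adj G h x) where

  ReachIn-hub : ∀ {x} → x ∈ S → ReachIn G S x h
  ReachIn-hub {x} x∈S with x ≟ h
  ... | yes refl = here x∈S
  ... | no  x≢h  = step (here x∈S) h∈S (Adj-sym G (hub x∈S x≢h))

  ConnectedIn-hub : ConnectedIn G S
  ConnectedIn-hub x y x∈S y∈S with y ≟ h
  ... | yes refl = ReachIn-hub x∈S
  ... | no  y≢h  = step (ReachIn-hub x∈S) y∈S (hub y∈S y≢h)

module _ {m n : ℕ} (G₁ : Graph m) (G₂ : Graph n) where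

  private
    J : Graph (m + n)
    J = G₁ ∨G G₂

  E-∨G-↑ˡ↑ˡ : ∀ i j → E J (i ↑ˡ n) (j ↑ˡ n) ≡ E G₁ i j
  E-∨G-↑ˡ↑ˡ i j rewrite splitAt-↑ˡ m i n | splitAt-↑ˡ m j n = refl

  E-∨G-↑ʳ↑ʳ : ∀ i j → E J (m ↑ʳ i) (m ↑ʳ j) ≡ E G₂ i j
  E-∨G-↑ʳ↑ʳ i j rewrite splitAt-↑ʳ m n i | splitAt-↑ʳ m n j = refl

  Adj-∨G-↑ˡ↑ʳ : ∀ i j → Adj J (i ↑ˡ n) (m ↑ʳ j)
  Adj-∨G-↑ˡ↑ʳ i j rewrite splitAt-↑ˡ m i n | splitAt-↑ʳ m n j = tt

  Adj-∨G-↑ʳ↑ʳ⁺ : ∀ {i j} → Adj G₂ i j → Adj J (m ↑ʳ i) (m ↑ʳ j)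
  Adj-∨G-↑ʳ↑ʳ⁺ {i} {j} = subst T (sym (E-∨G-↑ʳ↑ʳ i j))

  Adj-∨G-↑ʳ↑ʳ⁻ : ∀ {i j} → Adj J (m ↑ʳ i) (m ↑ʳ j) → Adj G₂ i j
  Adj-∨G-↑ʳ↑ʳ⁻ {i} {j} = subst T (E-∨G-↑ʳ↑ʳ i j)

  IsCDS-∨G⁺ : IsComplete G₁ → ∀ (p : Subset m) {q} → IsCDS G₂ q → IsCDS J (p ++ q)
  IsCDS-∨G⁺ complete p cds x y x∉ y∉ x≢y with splitView m x | splitView m y
  ... | left i  | left j  =
    subst T (sym (E-∨G-↑ˡ↑ˡ i j)) (complete i j (λ i≡j → x≢y (cong (_↑ˡ n) i≡j)))
  ... | left i  | right j = Adj-∨G-↑ˡ↑ʳ i j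
  ... | right i | left j  = Adj-sym J (Adj-∨G-↑ˡ↑ʳ j i)
  ... | right i | right j =
    Adj-∨G-↑ʳ↑ʳ⁺ (cds i j (λ i∈q → x∉ (∈-++⁺ʳ i∈q)) (λ j∈q → y∉ (∈-++⁺ʳ j∈q))
                         (λ i≡j → x≢y (cong (m ↑ʳ_) i≡j)))

  IsCDS-∨G⁻ : ∀ (p : Subset m) {q} → IsCDS J (p ++ q) → IsCDS G₂ q
  IsCDS-∨G⁻ p cds i j i∉q j∉q i≢j =
    Adj-∨G-↑ʳ↑ʳ⁻ (cds (m ↑ʳ i) (m ↑ʳ j)
                      (λ i∈ → i∉q (∈-++⁻ʳ {p = p} i∈)) (λ j∈ → j∉q (∈-++⁻ʳ {p = p} j∈))
                      (λ i≡j → i≢j (↑ʳ-injective m i j i≡j)))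

  ReachIn-∨G⁺ : ∀ {p : Subset m} {q u v} →
                ReachIn G₂ q u v → ReachIn J (p ++ q) (m ↑ʳ u) (m ↑ʳ v)
  ReachIn-∨G⁺ (here u∈q)       = here (∈-++⁺ʳ u∈q)
  ReachIn-∨G⁺ (step r v∈q adj) = step (ReachIn-∨G⁺ r) (∈-++⁺ʳ v∈q) (Adj-∨G-↑ʳ↑ʳ⁺ adj)

  ReachIn-∨G⁻ : ∀ {q u x} → ReachIn J (⊥ ++ q) (m ↑ʳ u) x →
                ∀ v → x ≡ m ↑ʳ v → ReachIn G₂ q u v
  ReachIn-∨G⁻ {u = u} (here u∈) v u≡v =
    subst (ReachIn G₂ _ u) (↑ʳ-injective m u v u≡v) (here (∈-++⁻ʳ {p = ⊥} u∈))
  ReachIn-∨G⁻ (step {w} r x∈ adj) v refl with splitView m w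
  ... | left i  = ⊥-elim (∉⊥ (∈-++⁻ˡ (ReachIn-∈ r)))
  ... | right k = step (ReachIn-∨G⁻ r k refl) (∈-++⁻ʳ {p = ⊥} x∈) (Adj-∨G-↑ʳ↑ʳ⁻ adj)

  ConnectedIn-∨G⁺ : ∀ {q} → ConnectedIn G₂ q → ConnectedIn J (⊥ ++ q)
  ConnectedIn-∨G⁺ conn x y x∈ y∈ with splitView m x | splitView m y
  ... | left i  | _       = ⊥-elim (∉⊥ (∈-++⁻ˡ x∈))
  ... | right _ | left j  = ⊥-elim (∉⊥ (∈-++⁻ˡ y∈))
  ... | right i | right j =
    ReachIn-∨G⁺ (conn i j (∈-++⁻ʳ {p = ⊥} x∈) (∈-++⁻ʳ {p = ⊥} y∈))

  ConnectedIn-∨G⁻ : ∀ {q} → ConnectedIn J (⊥ ++ q) → ConnectedIn G₂ q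
  ConnectedIn-∨G⁻ conn u v u∈ v∈ = ReachIn-∨G⁻ (conn _ _ (∈-++⁺ʳ u∈) (∈-++⁺ʳ v∈)) v refl

  ConnectedIn-∨G-⁅⁆ : ∀ (c : Fin m) q → ConnectedIn J (⁅ c ⁆ ++ q)
  ConnectedIn-∨G-⁅⁆ c q = ConnectedIn-hub J (∈-++⁺ˡ (x∈⁅x⁆ c)) adjacent
    where
    adjacent : ∀ {x} → x ∈ ⁅ c ⁆ ++ q → x ≢ c ↑ˡ n → Adj J (c ↑ˡ n) x
    adjacent {x} x∈ x≢c with splitView m x
    ... | left i  = ⊥-elim (x≢c (cong (_↑ˡ n) (x∈⁅y⁆⇒x≡y c (∈-++⁻ˡ x∈))))
    ... | right j = Adj-∨G-↑ˡ↑ʳ c j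

  IsCCDS-∨G⁻ : ∀ s → IsCCDS J s →
    (Σ (Subset n) λ q → IsCCDS G₂ q × ∣ q ∣ ≤ ∣ s ∣) ⊎
    (Σ (Subset n) λ q → IsCDS G₂ q × suc ∣ q ∣ ≤ ∣ s ∣)
  IsCCDS-∨G⁻ s _ with Vec.splitAt m s
  IsCCDS-∨G⁻ _ (cds , conn) | p , q , refl with nonempty? p
  ... | yes (_ , i∈p) =
    inj₂ (q , IsCDS-∨G⁻ p cds ,
          subst (suc ∣ q ∣ ≤_) (sym (∣p++q∣≡∣p∣+∣q∣ p q)) (+-mono-≤ (x∈p⇒1≤∣p∣ i∈p) ≤-refl))
  ... | no p-empty with Empty-unique p-empty
  ...   | refl =
    inj₁ (q , (IsCDS-∨G⁻ ⊥ cds , ConnectedIn-∨G⁻ conn) , ≤-reflexive (sym (∣⊥++q∣≡∣q∣ m q)))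

  ⊥++-IsCCDS-∨G : IsComplete G₁ → ∀ q → IsCCDS G₂ q →
                   Σ (Subset (m + n)) λ s → IsCCDS J s × ∣ s ∣ ≡ ∣ q ∣
  ⊥++-IsCCDS-∨G complete q (cds , conn) =
    ⊥ ++ q , (IsCDS-∨G⁺ complete ⊥ cds , ConnectedIn-∨G⁺ conn) , ∣⊥++q∣≡∣q∣ m q

  ⁅c⁆++-IsCCDS-∨G : IsComplete G₁ → Fin m → ∀ q → IsCDS G₂ q →
                     Σ (Subset (m + n)) λ s → IsCCDS J s × ∣ s ∣ ≡ suc ∣ q ∣
  ⁅c⁆++-IsCCDS-∨G complete c q cds =
    ⁅ c ⁆ ++ q , (IsCDS-∨G⁺ complete ⁅ c ⁆ cds , ConnectedIn-∨G-⁅⁆ c q) , ∣⁅c⁆++q∣≡1+∣q∣ c q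

IsMinCard : ∀ {k} → (Subset k → Set) → ℕ∞ → Set
IsMinCard P nothing  = ∀ S → ¬ P S
IsMinCard {k} P (just c) =
  Σ (Subset k) (λ S → P S × ∣ S ∣ ≡ c) × (∀ S → P S → c ≤ ∣ S ∣)

IsThetaC⇒IsMinCard : ∀ {k} {G : Graph k} a → IsThetaC G a → IsMinCard (IsCCDS G) a
IsThetaC⇒IsMinCard nothing  θc = θc
IsThetaC⇒IsMinCard (just _) θc = θc

IsMinCard⇒IsThetaC : ∀ {k} {G : Graph k} a → IsMinCard (IsCCDS G) a → IsThetaC G a
IsMinCard⇒IsThetaC nothing  θc = θc
IsMinCard⇒IsThetaC (just _) θc = θc

module _ {k l r} {P : Subset k → Set} {Q : Subset l → Set} {R : Subset r → Set} {b : ℕ}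
         (R-min : IsMinCard R (just b))
         (Q⇒P : ∀ q → Q q → Σ (Subset k) λ s → P s × ∣ s ∣ ≡ ∣ q ∣)
         (R⇒P : ∀ q → R q → Σ (Subset k) λ s → P s × ∣ s ∣ ≡ suc ∣ q ∣)
         (P⇒Q⊎R : ∀ s → P s → (Σ (Subset l) λ q → Q q × ∣ q ∣ ≤ ∣ s ∣) ⊎
                                (Σ (Subset r) λ q → R q × suc ∣ q ∣ ≤ ∣ s ∣)) where

  private
    viaR : Σ (Subset k) λ s → P s × ∣ s ∣ ≡ suc b
    viaR with proj₁ R-min
    ... | q , Rq , ∣q∣≡b with R⇒P q Rq
    ...   | s , Ps , ∣s∣≡1+∣q∣ = s , Ps , trans ∣s∣≡1+∣q∣ (cong suc ∣q∣≡b)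

    viaR-lower : (s : Subset k) →
                 (Σ (Subset r) λ q → R q × suc ∣ q ∣ ≤ ∣ s ∣) → suc b ≤ ∣ s ∣
    viaR-lower _ (q , Rq , 1+∣q∣≤∣s∣) = ≤-trans (s≤s (proj₂ R-min q Rq)) 1+∣q∣≤∣s∣

  IsMinCard-⊓ : ∀ a → IsMinCard Q a → IsMinCard P (min∞ a (just (suc b)))
  IsMinCard-⊓ nothing noQ = viaR , lower
    where
    lower : ∀ s → P s → suc b ≤ ∣ s ∣
    lower s Ps with P⇒Q⊎R s Ps
    ... | inj₁ (q , Qq , _) = ⊥-elim (noQ q Qq)
    ... | inj₂ viaR-set     = viaR-lower s viaR-set
  IsMinCard-⊓ (just a) ((q₀ , Qq₀ , ∣q₀∣≡a) , a≤) = witness , lower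
    where
    witness : Σ (Subset k) λ s → P s × ∣ s ∣ ≡ a ⊓ suc b
    witness with ⊓-sel a (suc b) | Q⇒P q₀ Qq₀ | viaR
    ... | inj₁ a⊓1+b≡a   | s , Ps , ∣s∣≡∣q₀∣ | _ =
      s , Ps , trans ∣s∣≡∣q₀∣ (trans ∣q₀∣≡a (sym a⊓1+b≡a))
    ... | inj₂ a⊓1+b≡1+b | _ | s , Ps , ∣s∣≡1+b =
      s , Ps , trans ∣s∣≡1+b (sym a⊓1+b≡1+b)
    lower : ∀ s → P s → a ⊓ suc b ≤ ∣ s ∣
    lower s Ps with P⇒Q⊎R s Ps
    ... | inj₁ (q , Qq , ∣q∣≤∣s∣) = ≤-trans (m⊓n≤m a (suc b)) (≤-trans (a≤ q Qq) ∣q∣≤∣s∣)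
    ... | inj₂ viaR-set           = ≤-trans (m⊓n≤n a (suc b)) (viaR-lower s viaR-set)

lemma21 : ∀ {m n : ℕ} (G₁ : Graph (suc m)) (G₂ : Graph n) →
    IsComplete G₁ →
    ∀ (a : ℕ∞) (b : ℕ) → IsThetaC G₂ a → IsTheta G₂ b →
    IsThetaC (G₁ ∨G G₂) (min∞ a (just (suc b)))
lemma21 G₁ G₂ complete a b θc θ =
  IsMinCard⇒IsThetaC (min∞ a (just (suc b)))
    (IsMinCard-⊓ θ (⊥++-IsCCDS-∨G G₁ G₂ complete) (⁅c⁆++-IsCCDS-∨G G₁ G₂ complete zero)
       (IsCCDS-∨G⁻ G₁ G₂) a (IsThetaC⇒IsMinCard a θc))
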